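{- If a graph $G$ belongs to the class $\mathbf{W}_2$, then $\partial(G)\ge |V(G)|-2\alpha(G)\ge \Delta(G)-1$.
   Context: Graphs are finite, simple, undirected, with non-empty vertex set. An independent set is a set of pairwise non-adjacent vertices; $\alpha(G)$ is the maximum size of an independent set. A graph belongs to $\mathbf{W}_2$ if every two disjoint independent sets are included, respectively, in two disjoint maximum independent sets. For $A\subseteq V(G)$, $N(A)=\{v: N(v)\cap A\ne\emptyset\}$, the differential of $A$ is $\partial(A)=|N(A)\setminus A|-|A|$, and $\partial(G)=\max\{\partial(A): A\subseteq V(G)\}$. $\Delta(G)$ is the maximum degree. -}

module Defs where

open import Data.Bool using (Bool; true; false; if_then_else_; _∨_; _∧_; not)
open import Data.Nat using (ℕ; zero; suc; _⊔_)
open import Data.Integer as ℤ using (ℤ; +_; _-_)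
open import Data.Fin using (Fin)
open import Data.Fin.Subset using (Subset; inside; outside; _∈_; _⊆_; _∩_; _─_; ∣_∣; Empty)
open import Data.Vec using (Vec; []; _∷_; tabulate; lookup)
open import Data.List using (List; []; _∷_; map; _++_; foldr; allFin)
open import Data.Bool.ListAction using (any; all)
open import Data.Product using (Σ; _×_; ∃₂)
open import Relation.Binary.PropositionalEquality using (_≡_)

record Graph (n : ℕ) : Set where
  field
    adj    : Fin n → Fin n → Bool
    sym    : ∀ u v → adj u v ≡ adj v u
    irrefl : ∀ v → adj v v ≡ false
open Graph public

allSubsets : (n : ℕ) → List (Subset n)
allSubsets zero    = [] ∷ []
allSubsets (suc n) = map (inside ∷_) (allSubsets n) ++ map (outside ∷_) (allSubsets n)

mem : ∀ {n} → Fin n → Subset n → Bool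
mem x p = lookup p x

Independent : ∀ {n} → Graph n → Subset n → Set
Independent G A = ∀ u v → u ∈ A → v ∈ A → adj G u v ≡ false

independent? : ∀ {n} → Graph n → Subset n → Bool
independent? {n} G A =
  all (λ u → all (λ v → not (mem u A ∧ mem v A ∧ adj G u v)) (allFin n)) (allFin n)

α : ∀ {n} → Graph n → ℕ
α {n} G = foldr (λ A m → (if independent? G A then ∣ A ∣ else 0) ⊔ m) 0 (allSubsets n)

MaxIndependent : ∀ {n} → Graph n → Subset n → Set
MaxIndependent G A = Independent G A × ∣ A ∣ ≡ α G

Disjoint : ∀ {n} → Subset n → Subset n → Set
Disjoint A B = Empty (A ∩ B)

W₂ : ∀ {n} → Graph n → Set
W₂ G = ∀ S₁ S₂ → Independent G S₁ → Independent G S₂ → Disjoint S₁ S₂ →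
       ∃₂ λ T₁ T₂ → MaxIndependent G T₁ × MaxIndependent G T₂ ×
                    S₁ ⊆ T₁ × S₂ ⊆ T₂ × Disjoint T₁ T₂

N : ∀ {n} → Graph n → Subset n → Subset n
N {n} G A = tabulate (λ v → if any (λ u → mem u A ∧ adj G v u) (allFin n) then inside else outside)

∂ : ∀ {n} → Graph n → Subset n → ℤ
∂ G A = + ∣ N G A ─ A ∣ - + ∣ A ∣

-- ∂(G) = max over all A ⊆ V(G) of ∂(A)  (the empty set gives 0, so
-- starting the fold at 0 does not change the maximum).
∂G : ∀ {n} → Graph n → ℤ
∂G {n} G = foldr (λ A m → ∂ G A ℤ.⊔ m) (+ 0) (allSubsets n)

deg : ∀ {n} → Graph n → Fin n → ℕ
deg {n} G v = foldr (λ u k → if adj G v u then suc k else k) 0 (allFin n)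

Δ : ∀ {n} → Graph n → ℕ
Δ {n} G = foldr (λ v m → deg G v ⊔ m) 0 (allFin n)

-- Take T a maximum independent set: by maximality every vertex outside T has a
-- neighbour in T, so N(T) ∖ T contains V ∖ T and ∂(T) ≥ (n − α) − α.
-- For the second inequality let v have maximum degree. W₂ extends {v} to a maximum
-- independent set S, and then splits S − v and {v} into disjoint maximum independent
-- sets A ⊇ S − v and B ∋ v. Now S − v, B and N(v) are pairwise disjoint (N(v) misses
-- S and B since both are independent and contain v), whence (α − 1) + α + Δ ≤ n.
module Submission where

open import Defs
open import Data.Nat using (ℕ; _*_; _<_)
open import Data.Integer using (+_; _-_; _≤_)
open import Data.Product using (_×_)

open import Algebra.Construct.NaturalChoice.Base using (MaxOperator)
import Algebra.Construct.NaturalChoice.MaxOp as MaxOp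
open import Data.Bool as Bool using (Bool; true; false; T; _∧_; if_then_else_)
open import Data.Bool.ListAction using (any)
open import Data.Bool.Properties using (T-≡; T-not-≡; ¬-not)
open import Data.Fin as Fin using (Fin; zero; suc)
open import Data.Fin.Properties using (any?)
open import Data.Fin.Subset using (Subset; inside; outside; _∈_; _∉_; _⊆_; _∪_; _─_; ∁; ⁅_⁆; ⊥; ∣_∣)
open import Data.Fin.Subset.Properties
  using (_∈?_; ∉⊥; x∈⁅x⁆; x∈⁅y⁆⇒x≡y; ∣⁅x⁆∣≡1; ∣p∣≤n; ∣∁p∣≡n∸∣p∣; p⊆q⇒∣p∣≤∣q∣; drop-∷-Empty;
         x∈p∩q⁺; x∈p∩q⁻; x∈p∪q⁺; x∈p∪q⁻; x∈∁p⇒x∉p; x∈p∧x∉q⇒x∈p─q; p─q⊆p; x∈p∧x≢y⇒x∈p-y)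
open import Data.Integer as ℤ using (_⊖_)
import Data.Integer.Properties as ℤ
open import Data.List as List using (List; []; _∷_; foldr; allFin)
open import Data.List.Membership.Propositional using () renaming (_∈_ to _∈ₗ_)
open import Data.List.Membership.Propositional.Properties using (∈-map⁺; ∈-++⁺ˡ; ∈-++⁺ʳ)
open import Data.List.Relation.Unary.Any using (here; there)
import Data.List.Relation.Unary.All.Properties as All
import Data.List.Relation.Unary.Any.Properties as Any
open import Data.Nat as ℕ using (zero; suc; _+_; _∸_; s≤s; z≤n)
import Data.Nat.Properties as ℕ
open import Data.Product using (∃-syntax; _,_)
open import Data.Sum using (_⊎_; inj₁; inj₂; [_,_])
open import Data.Vec as Vec using (_∷_; tabulate)
open import Data.Vec.Properties using (lookup∘tabulate; []=⇒lookup; lookup⇒[]=)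
open import Function using (_∘_; id; Equivalence)
open import Relation.Binary.Bundles using (TotalPreorder)
open import Relation.Binary.PropositionalEquality as ≡ using (_≡_; refl; trans; cong; cong₂; subst)
open import Relation.Nullary using (yes; no; contradiction; _×-dec_)

module _ {c ℓ₁ ℓ₂} {O : TotalPreorder c ℓ₁ ℓ₂} (maxOp : MaxOperator O) where
  open TotalPreorder O using (reflexive)
    renaming (Carrier to B; _≲_ to _≤ᴮ_; trans to ≤ᴮ-trans; refl to ≤ᴮ-refl)
  open MaxOperator maxOp using (_⊔_)
  open MaxOp maxOp using (x≤x⊔y; x≤y⊔x; ⊔-sel)

  module _ {a} {A : Set a} (f : A → B) (e : B) where

    foldr-⊔ : List A → B
    foldr-⊔ = foldr (λ x m → f x ⊔ m) e

    ≤-foldr-⊔ : ∀ {x xs} → x ∈ₗ xs → f x ≤ᴮ foldr-⊔ xs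
    ≤-foldr-⊔ (here refl)  = x≤x⊔y _ _
    ≤-foldr-⊔ {xs = y ∷ _} (there x∈xs) = ≤ᴮ-trans (≤-foldr-⊔ x∈xs) (x≤y⊔x (f y) _)

    foldr-⊔-sel : ∀ xs → foldr-⊔ xs ≤ᴮ e ⊎ ∃[ x ] (x ∈ₗ xs × foldr-⊔ xs ≤ᴮ f x)
    foldr-⊔-sel []       = inj₁ ≤ᴮ-refl
    foldr-⊔-sel (x ∷ xs) with ⊔-sel (f x) (foldr-⊔ xs) | foldr-⊔-sel xs
    ... | inj₁ ≈fx | _                      = inj₂ (x , here refl , reflexive ≈fx)
    ... | inj₂ ≈m  | inj₁ m≤e               = inj₁ (≤ᴮ-trans (reflexive ≈m) m≤e)
    ... | inj₂ ≈m  | inj₂ (y , y∈xs , m≤fy) = inj₂ (y , there y∈xs , ≤ᴮ-trans (reflexive ≈m) m≤fy)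

private
  variable
    n : ℕ
    p q r : Subset n
    x : Fin n

Disjoint⁺ : (∀ {x} → x ∈ p → x ∉ q) → Disjoint p q
Disjoint⁺ {p = p} {q} h (_ , x∈p∩q) = let x∈p , x∈q = x∈p∩q⁻ p q x∈p∩q in h x∈p x∈q

Disjoint⁻ : Disjoint p q → x ∈ p → x ∉ q
Disjoint⁻ p∩q≡∅ x∈p x∈q = p∩q≡∅ (_ , x∈p∩q⁺ (x∈p , x∈q))

Disjoint-∪ˡ : Disjoint p r → Disjoint q r → Disjoint (p ∪ q) r
Disjoint-∪ˡ {p = p} {q = q} p∩r≡∅ q∩r≡∅ =
  Disjoint⁺ λ x∈p∪q → [ Disjoint⁻ p∩r≡∅ , Disjoint⁻ q∩r≡∅ ] (x∈p∪q⁻ p q x∈p∪q)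

x∈p─q⇒x∉q : ∀ (p q : Subset n) → x ∈ p ─ q → x ∉ q
x∈p─q⇒x∉q (_ ∷ p) (outside ∷ q) Vec.here          ()
x∈p─q⇒x∉q (_ ∷ p) (_       ∷ q) (Vec.there x∈p─q) (Vec.there x∈q) = x∈p─q⇒x∉q p q x∈p─q x∈q

∣p∪q∣≡∣p∣+∣q∣ : ∀ (p q : Subset n) → Disjoint p q → ∣ p ∪ q ∣ ≡ ∣ p ∣ + ∣ q ∣
∣p∪q∣≡∣p∣+∣q∣ Vec.[]        Vec.[]        _      = refl
∣p∪q∣≡∣p∣+∣q∣ (inside  ∷ p) (inside  ∷ q) p∩q≡∅ = contradiction (zero , Vec.here) p∩q≡∅
∣p∪q∣≡∣p∣+∣q∣ (inside  ∷ p) (outside ∷ q) p∩q≡∅ = cong suc (∣p∪q∣≡∣p∣+∣q∣ p q (drop-∷-Empty p∩q≡∅))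
∣p∪q∣≡∣p∣+∣q∣ (outside ∷ p) (inside  ∷ q) p∩q≡∅ =
  trans (cong suc (∣p∪q∣≡∣p∣+∣q∣ p q (drop-∷-Empty p∩q≡∅))) (≡.sym (ℕ.+-suc ∣ p ∣ ∣ q ∣))
∣p∪q∣≡∣p∣+∣q∣ (outside ∷ p) (outside ∷ q) p∩q≡∅ = ∣p∪q∣≡∣p∣+∣q∣ p q (drop-∷-Empty p∩q≡∅)

∣p∣+∣q∣≤n : ∀ (p q : Subset n) → Disjoint p q → ∣ p ∣ + ∣ q ∣ ℕ.≤ n
∣p∣+∣q∣≤n p q p∩q≡∅ = subst (ℕ._≤ _) (∣p∪q∣≡∣p∣+∣q∣ p q p∩q≡∅) (∣p∣≤n (p ∪ q))

∣p∣+∣q∣+∣r∣≤n : ∀ (p q r : Subset n) → Disjoint p q → Disjoint p r → Disjoint q r →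
                ∣ p ∣ + ∣ q ∣ + ∣ r ∣ ℕ.≤ n
∣p∣+∣q∣+∣r∣≤n p q r p∩q≡∅ p∩r≡∅ q∩r≡∅ =
  subst (λ k → k + ∣ r ∣ ℕ.≤ _) (∣p∪q∣≡∣p∣+∣q∣ p q p∩q≡∅)
        (∣p∣+∣q∣≤n (p ∪ q) r (Disjoint-∪ˡ p∩r≡∅ q∩r≡∅))

∣p∣≤1+∣p─⁅x⁆∣ : ∀ (p : Subset n) x → ∣ p ∣ ℕ.≤ suc ∣ p ─ ⁅ x ⁆ ∣
∣p∣≤1+∣p─⁅x⁆∣ p x = begin
  ∣ p ∣                     ≤⟨ p⊆q⇒∣p∣≤∣q∣ p⊆⁅x⁆∪[p─⁅x⁆] ⟩
  ∣ ⁅ x ⁆ ∪ (p ─ ⁅ x ⁆) ∣   ≡⟨ ∣p∪q∣≡∣p∣+∣q∣ ⁅ x ⁆ (p ─ ⁅ x ⁆) ⁅x⁆∩[p─⁅x⁆]≡∅ ⟩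
  (∣ ⁅ x ⁆ ∣ + ∣ p ─ ⁅ x ⁆ ∣) ≡⟨ cong (ℕ._+ ∣ p ─ ⁅ x ⁆ ∣) (∣⁅x⁆∣≡1 x) ⟩
  suc ∣ p ─ ⁅ x ⁆ ∣         ∎
  where
  open ℕ.≤-Reasoning
  ⁅x⁆∩[p─⁅x⁆]≡∅ : Disjoint ⁅ x ⁆ (p ─ ⁅ x ⁆)
  ⁅x⁆∩[p─⁅x⁆]≡∅ = Disjoint⁺ λ y∈⁅x⁆ y∈p─⁅x⁆ → x∈p─q⇒x∉q p ⁅ x ⁆ y∈p─⁅x⁆ y∈⁅x⁆
  p⊆⁅x⁆∪[p─⁅x⁆] : p ⊆ ⁅ x ⁆ ∪ (p ─ ⁅ x ⁆)
  p⊆⁅x⁆∪[p─⁅x⁆] {y} y∈p with y Fin.≟ x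
  ... | yes refl = x∈p∪q⁺ (inj₁ (x∈⁅x⁆ x))
  ... | no  y≢x  = x∈p∪q⁺ (inj₂ (x∈p∧x≢y⇒x∈p-y y∈p y≢x))

[+m]-[+n]≤[+o]-[+p] : ∀ m n o p → m + p ℕ.≤ o + n → + m - + n ≤ + o - + p
[+m]-[+n]≤[+o]-[+p] m n o p m+p≤o+n = begin
  + m - + n           ≡⟨ ℤ.[+m]-[+n]≡m⊖n m n ⟩
  m ⊖ n               ≡⟨ ℤ.+-cancelˡ-⊖ p m n ⟨
  (p + m) ⊖ (p + n)   ≤⟨ ℤ.⊖-monoˡ-≤ (p + n) (subst (ℕ._≤ o + n) (ℕ.+-comm m p) m+p≤o+n) ⟩
  (o + n) ⊖ (p + n)   ≡⟨ cong₂ _⊖_ (ℕ.+-comm o n) (ℕ.+-comm p n) ⟩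
  (n + o) ⊖ (n + p)   ≡⟨ ℤ.+-cancelˡ-⊖ n o p ⟩
  o ⊖ p               ≡⟨ ℤ.[+m]-[+n]≡m⊖n o p ⟨
  + o - + p           ∎
  where open ℤ.≤-Reasoning

2*m≡m+m : ∀ m → 2 * m ≡ m + m
2*m≡m+m m = cong (m ℕ.+_) (ℕ.+-identityʳ m)

∈-allSubsets : ∀ (p : Subset n) → p ∈ₗ allSubsets n
∈-allSubsets Vec.[]        = here refl
∈-allSubsets (inside  ∷ p) = ∈-++⁺ˡ (∈-map⁺ (inside ∷_) (∈-allSubsets p))
∈-allSubsets {suc n} (outside ∷ p) =
  ∈-++⁺ʳ (List.map (inside ∷_) (allSubsets n)) (∈-map⁺ (outside ∷_) (∈-allSubsets p))

count-tabulate : ∀ {m} (f : Fin m → Bool) (g : Fin n → Fin m) →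
  foldr (λ u k → if f u then suc k else k) 0 (List.tabulate g) ≡ ∣ tabulate (f ∘ g) ∣
count-tabulate {zero}  f g = refl
count-tabulate {suc n} f g with f (g zero)
... | true  = cong suc (count-tabulate f (g ∘ suc))
... | false = count-tabulate f (g ∘ suc)

module _ (G : Graph n) where

  neighbours : Fin n → Subset n
  neighbours v = tabulate (adj G v)

  deg≡∣neighbours∣ : ∀ v → deg G v ≡ ∣ neighbours v ∣
  deg≡∣neighbours∣ v = count-tabulate (adj G v) id

  Independent-⊆ : ∀ {S A} → S ⊆ A → Independent G A → Independent G S
  Independent-⊆ S⊆A I u v u∈S v∈S = I u v (S⊆A u∈S) (S⊆A v∈S)

  Independent-⊥ : Independent G ⊥
  Independent-⊥ u v u∈⊥ = contradiction u∈⊥ ∉⊥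

  Independent-⁅⁆ : ∀ x → Independent G ⁅ x ⁆
  Independent-⁅⁆ x u v u∈⁅x⁆ v∈⁅x⁆
    rewrite x∈⁅y⁆⇒x≡y x u∈⁅x⁆ | x∈⁅y⁆⇒x≡y x v∈⁅x⁆ = irrefl G x

  Independent-insert : ∀ {A} → Independent G A → (∀ {u} → u ∈ A → adj G x u ≡ false) →
                       Independent G (⁅ x ⁆ ∪ A)
  Independent-insert {x = x} {A} I x≁A u v u∈ v∈ with x∈p∪q⁻ ⁅ x ⁆ A u∈ | x∈p∪q⁻ ⁅ x ⁆ A v∈
  ... | inj₁ u∈⁅x⁆ | inj₁ v∈⁅x⁆ = Independent-⁅⁆ x u v u∈⁅x⁆ v∈⁅x⁆
  ... | inj₁ u∈⁅x⁆ | inj₂ v∈A rewrite x∈⁅y⁆⇒x≡y x u∈⁅x⁆ = x≁A v∈A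
  ... | inj₂ u∈A | inj₁ v∈⁅x⁆ rewrite x∈⁅y⁆⇒x≡y x v∈⁅x⁆ = trans (Graph.sym G u x) (x≁A u∈A)
  ... | inj₂ u∈A | inj₂ v∈A = I u v u∈A v∈A

  Disjoint-neighbours : ∀ {S v} → Independent G S → v ∈ S → Disjoint S (neighbours v)
  Disjoint-neighbours {S} {v} I v∈S = Disjoint⁺ λ {x} x∈S x∈N[v] →
    contradiction (trans (≡.sym (I v x v∈S x∈S)) (adj-from x∈N[v])) λ ()
    where
    adj-from : ∀ {x} → x ∈ neighbours v → adj G v x ≡ true
    adj-from {x} x∈N[v] = trans (≡.sym (lookup∘tabulate (adj G v) x)) ([]=⇒lookup x∈N[v])

  independent?-complete : ∀ {A} → Independent G A → independent? G A ≡ true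
  independent?-complete {A} I = Equivalence.to T-≡ (All.all⁻ _ (All.tabulate⁺ λ u →
    All.all⁻ _ (All.tabulate⁺ λ v → Equivalence.from T-not-≡ (not-both u v))))
    where
    not-both : ∀ u v → mem u A ∧ mem v A ∧ adj G u v ≡ false
    not-both u v with mem u A in u∈A | mem v A in v∈A
    ... | false | _     = refl
    ... | true  | false = refl
    ... | true  | true  = I u v (lookup⇒[]= u A u∈A) (lookup⇒[]= v A v∈A)

  ∣A∣≤α : ∀ {A} → Independent G A → ∣ A ∣ ℕ.≤ α G
  ∣A∣≤α {A} I = subst (λ b → (if b then ∣ A ∣ else 0) ℕ.≤ α G) (independent?-complete I)
    (≤-foldr-⊔ ℕ.⊔-operator (λ B → if independent? G B then ∣ B ∣ else 0) 0 (∈-allSubsets A))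

  ∈N⁺ : ∀ {A u} → u ∈ A → adj G x u ≡ true → x ∈ N G A
  ∈N⁺ {x} {A} {u} u∈A x~u = lookup⇒[]= x (N G A) (trans (lookup∘tabulate _ x)
    (cong (λ b → if b then inside else outside) (Equivalence.to T-≡ some-neighbour-in-A)))
    where
    some-neighbour-in-A : T (any (λ w → mem w A ∧ adj G x w) (allFin n))
    some-neighbour-in-A = Any.any⁺ _ (Any.tabulate⁺ u
      (Equivalence.from T-≡ (cong₂ _∧_ ([]=⇒lookup u∈A) x~u)))

  MaxIndependent⇒dominating : ∀ {A} → MaxIndependent G A → x ∉ A → x ∈ N G A
  MaxIndependent⇒dominating {x} {A} (I , ∣A∣≡α) x∉A
    with any? (λ u → (u ∈? A) ×-dec (adj G x u Bool.≟ true))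
  ... | yes (u , u∈A , x~u) = ∈N⁺ u∈A x~u
  ... | no  x≁A = contradiction (subst (ℕ._≤ α G) ∣⁅x⁆∪A∣≡1+α (∣A∣≤α (Independent-insert I x≁A′)))
                                (ℕ.n≮n (α G))
    where
    x≁A′ : ∀ {u} → u ∈ A → adj G x u ≡ false
    x≁A′ u∈A = ¬-not λ x~u → x≁A (_ , u∈A , x~u)
    ⁅x⁆∩A≡∅ : Disjoint ⁅ x ⁆ A
    ⁅x⁆∩A≡∅ = Disjoint⁺ λ y∈⁅x⁆ y∈A → x∉A (subst (_∈ A) (x∈⁅y⁆⇒x≡y x y∈⁅x⁆) y∈A)
    ∣⁅x⁆∪A∣≡1+α : ∣ ⁅ x ⁆ ∪ A ∣ ≡ suc (α G)
    ∣⁅x⁆∪A∣≡1+α = trans (∣p∪q∣≡∣p∣+∣q∣ ⁅ x ⁆ A ⁅x⁆∩A≡∅) (cong₂ _+_ (∣⁅x⁆∣≡1 x) ∣A∣≡α)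

  ∂≤∂G : ∀ A → ∂ G A ≤ ∂G G
  ∂≤∂G A = ≤-foldr-⊔ ℤ.⊔-operator (∂ G) (+ 0) (∈-allSubsets A)

  n-2α≤∂ : ∀ {A} → MaxIndependent G A → + n - + (2 * α G) ≤ ∂ G A
  n-2α≤∂ {A} M@(_ , ∣A∣≡α) = [+m]-[+n]≤[+o]-[+p] n (2 * α G) c a (begin
    n + a             ≡⟨ cong (_+ a) (ℕ.m∸n+n≡m (∣p∣≤n A)) ⟨
    (n ∸ a + a) + a   ≤⟨ ℕ.+-monoˡ-≤ a (ℕ.+-monoˡ-≤ a n∸a≤c) ⟩
    (c + a) + a       ≡⟨ ℕ.+-assoc c a a ⟩
    c + (a + a)       ≡⟨ cong (c ℕ.+_) (trans (≡.sym (2*m≡m+m a)) (cong (2 *_) ∣A∣≡α)) ⟩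
    c + 2 * α G       ∎)
    where
    open ℕ.≤-Reasoning
    a = ∣ A ∣
    c = ∣ N G A ─ A ∣
    ∁A⊆N[A]─A : ∁ A ⊆ N G A ─ A
    ∁A⊆N[A]─A x∈∁A = x∈p∧x∉q⇒x∈p─q (MaxIndependent⇒dominating M (x∈∁p⇒x∉p x∈∁A)) (x∈∁p⇒x∉p x∈∁A)
    n∸a≤c : n ∸ a ℕ.≤ c
    n∸a≤c = subst (ℕ._≤ c) (∣∁p∣≡n∸∣p∣ A) (p⊆q⇒∣p∣≤∣q∣ ∁A⊆N[A]─A)

  W₂-extend : W₂ G → ∀ {S} → Independent G S → ∃[ A ] MaxIndependent G A × S ⊆ A
  W₂-extend w I with w _ ⊥ I Independent-⊥ (Disjoint⁺ λ _ → ∉⊥)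
  ... | A , _ , M , _ , S⊆A , _ = A , M , S⊆A

  W₂⇒deg+2α≤1+n : W₂ G → ∀ v → deg G v + 2 * α G ℕ.≤ suc n
  W₂⇒deg+2α≤1+n w v with W₂-extend w (Independent-⁅⁆ v)
  ... | S , (I-S , ∣S∣≡α) , ⁅v⁆⊆S
    with w (S ─ ⁅ v ⁆) ⁅ v ⁆ (Independent-⊆ (p─q⊆p S ⁅ v ⁆) I-S) (Independent-⁅⁆ v)
           (Disjoint⁺ (x∈p─q⇒x∉q S ⁅ v ⁆))
  ... | A , B , _ , (I-B , ∣B∣≡α) , S─v⊆A , ⁅v⁆⊆B , A∩B≡∅ = begin
    deg G v + 2 * α G                    ≡⟨ cong₂ _+_ (deg≡∣neighbours∣ v) (2*m≡m+m (α G)) ⟩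
    ∣ neighbours v ∣ + (α G + α G)       ≡⟨ ℕ.+-comm ∣ neighbours v ∣ _ ⟩
    (α G + α G) + ∣ neighbours v ∣
      ≤⟨ ℕ.+-monoˡ-≤ _ (ℕ.+-mono-≤ α≤1+∣S─v∣ (ℕ.≤-reflexive (≡.sym ∣B∣≡α))) ⟩
    suc (∣ S ─ ⁅ v ⁆ ∣ + ∣ B ∣ + ∣ neighbours v ∣)
      ≤⟨ s≤s (∣p∣+∣q∣+∣r∣≤n (S ─ ⁅ v ⁆) B (neighbours v) S─v∩B≡∅ S─v∩N[v]≡∅ B∩N[v]≡∅) ⟩
    suc n                                ∎
    where
    open ℕ.≤-Reasoning
    α≤1+∣S─v∣ : α G ℕ.≤ suc ∣ S ─ ⁅ v ⁆ ∣
    α≤1+∣S─v∣ = subst (ℕ._≤ _) ∣S∣≡α (∣p∣≤1+∣p─⁅x⁆∣ S v)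
    S─v∩B≡∅ : Disjoint (S ─ ⁅ v ⁆) B
    S─v∩B≡∅ = Disjoint⁺ λ x∈S─v → Disjoint⁻ A∩B≡∅ (S─v⊆A x∈S─v)
    S─v∩N[v]≡∅ : Disjoint (S ─ ⁅ v ⁆) (neighbours v)
    S─v∩N[v]≡∅ = Disjoint⁺ λ x∈S─v →
      Disjoint⁻ (Disjoint-neighbours I-S (⁅v⁆⊆S (x∈⁅x⁆ v))) (p─q⊆p S ⁅ v ⁆ x∈S─v)
    B∩N[v]≡∅ : Disjoint B (neighbours v)
    B∩N[v]≡∅ = Disjoint-neighbours I-B (⁅v⁆⊆B (x∈⁅x⁆ v))

  ∃deg≥Δ : 0 < n → ∃[ v ] Δ G ℕ.≤ deg G v
  ∃deg≥Δ 0<n with foldr-⊔-sel ℕ.⊔-operator (deg G) 0 (allFin n)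
  ... | inj₁ Δ≤0               = Fin.fromℕ< 0<n , ℕ.≤-trans Δ≤0 z≤n
  ... | inj₂ (v , _ , Δ≤deg[v]) = v , Δ≤deg[v]

corollary2p7 : ∀ (n : ℕ) → 0 < n → (G : Graph n) → W₂ G →
    (+ n - + (2 * α G) ≤ ∂G G) × (+ Δ G - + 1 ≤ + n - + (2 * α G))
corollary2p7 n 0<n G w = n-2α≤∂G , Δ-1≤n-2α
  where
  n-2α≤∂G : + n - + (2 * α G) ≤ ∂G G
  n-2α≤∂G with W₂-extend G w (Independent-⊥ G)
  ... | A , M , _ = ℤ.≤-trans (n-2α≤∂ G M) (∂≤∂G G A)
  Δ-1≤n-2α : + Δ G - + 1 ≤ + n - + (2 * α G)
  Δ-1≤n-2α with ∃deg≥Δ G 0<n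
  ... | v , Δ≤deg[v] = [+m]-[+n]≤[+o]-[+p] (Δ G) 1 n (2 * α G) (begin
    Δ G + 2 * α G      ≤⟨ ℕ.+-monoˡ-≤ (2 * α G) Δ≤deg[v] ⟩
    deg G v + 2 * α G  ≤⟨ W₂⇒deg+2α≤1+n G w v ⟩
    suc n              ≡⟨ ℕ.+-comm 1 n ⟩
    n + 1              ∎)
    where open ℕ.≤-Reasoning
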